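{- Every complete bipartite graph $K_{p,q}$ ($p,q\ge 1$) is $S$-determined.
   Context: All graphs are finite and simple. For a graph $G$ with vertices $v_1,\ldots,v_n$, the Seidel matrix $S(G)$ is $J-I-2A(G)$, where $A(G)$ is the adjacency matrix, $J$ the all-ones matrix and $I$ the identity; its eigenvalue multiset is the Seidel spectrum of $G$. For a partition $V(G)=U\cup W$, Seidel switching with respect to $U$ deletes all edges between $U$ and $W$ and adds an edge between $u\in U$, $w\in W$ whenever $uw$ was not an edge. Two graphs are switching equivalent if one is obtained from the other by a Seidel switching. A graph $G$ is $S$-determined (Seidel determined up to switching) if every graph with the same Seidel spectrum as $G$ is switching equivalent to a graph isomorphic to $G$. -}

module Defs where

open import Data.Nat using (ℕ; zero; suc; _+_; _<ᵇ_; _≥_)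
open import Data.Integer as ℤ using (ℤ; -_) renaming (_+_ to _+ℤ_; _*_ to _*ℤ_)
open import Data.Fin using (Fin; zero; suc; toℕ; punchIn; _≟_)
open import Data.Bool using (Bool; true; false; not; _xor_; if_then_else_)
open import Data.List using (List; []; _∷_; map)
open import Data.Product using (Σ; ∃; _×_; _,_)
open import Relation.Nullary using (yes; no)
open import Relation.Binary.PropositionalEquality using (_≡_; refl)

record Graph (n : ℕ) : Set where
  field
    adj    : Fin n → Fin n → Bool
    sym    : ∀ i j → adj i j ≡ adj j i
    irrefl : ∀ i → adj i i ≡ false
open Graph public

-- Seidel matrix S(G) = J - I - 2A(G)  (entries in ℤ)

SeidelMatrix : ∀ {n} → Graph n → Fin n → Fin n → ℤ
SeidelMatrix G i j with i ≟ j
... | yes _ = ℤ.0ℤ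
... | no  _ = if adj G i j then ℤ.-1ℤ else ℤ.1ℤ

-- Integer polynomials as little-endian coefficient lists

Poly : Set
Poly = List ℤ

_+P_ : Poly → Poly → Poly
[]      +P q       = q
(a ∷ p) +P []      = a ∷ p
(a ∷ p) +P (b ∷ q) = (a +ℤ b) ∷ (p +P q)

-P_ : Poly → Poly
-P p = map -_ p

_*P_ : Poly → Poly → Poly
[]      *P q = []
(a ∷ p) *P q = map (a *ℤ_) q +P (ℤ.0ℤ ∷ (p *P q))

oneP : Poly
oneP = ℤ.1ℤ ∷ []

coeff : Poly → ℕ → ℤ
coeff []      _       = ℤ.0ℤ
coeff (a ∷ p) zero    = a
coeff (a ∷ p) (suc k) = coeff p k

altSum : ∀ {n} → (Fin n → Poly) → Poly
altSum {zero}  f = []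
altSum {suc n} f = f zero +P (-P altSum (λ j → f (suc j)))

det : ∀ {n} → (Fin n → Fin n → Poly) → Poly
det {zero}  M = oneP
det {suc n} M = altSum (λ j → M zero j *P det (λ i k → M (suc i) (punchIn j k)))

charPoly : ∀ {n} → (Fin n → Fin n → ℤ) → Poly
charPoly {n} S = det λ i j → entry i j
  where
  entry : Fin n → Fin n → Poly
  entry i j with i ≟ j
  ... | yes _ = (- S i j) ∷ ℤ.1ℤ ∷ []
  ... | no  _ = (- S i j) ∷ []

SeidelCospectral : ∀ {m n} → Graph m → Graph n → Set
SeidelCospectral G H =
  ∀ k → coeff (charPoly (SeidelMatrix G)) k ≡ coeff (charPoly (SeidelMatrix H)) k

xor-sym : ∀ a b → a xor b ≡ b xor a
xor-sym false false = refl
xor-sym false true  = refl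
xor-sym true  false = refl
xor-sym true  true  = refl

xor-self : ∀ a → a xor a ≡ false
xor-self false = refl
xor-self true  = refl

switchAdj : ∀ {n} → Graph n → (Fin n → Bool) → Fin n → Fin n → Bool
switchAdj G U i j = if U i xor U j then not (adj G i j) else adj G i j

switch-sym : ∀ {n} (G : Graph n) U i j → switchAdj G U i j ≡ switchAdj G U j i
switch-sym G U i j with U i | U j | adj G i j | adj G j i | sym G i j
... | false | false | a | .a | refl = refl
... | false | true  | a | .a | refl = refl
... | true  | false | a | .a | refl = refl
... | true  | true  | a | .a | refl = refl

switch-irrefl : ∀ {n} (G : Graph n) U i → switchAdj G U i i ≡ false
switch-irrefl G U i with U i | adj G i i | irrefl G i
... | false | .false | refl = refl
... | true  | .false | refl = refl

switch : ∀ {n} → Graph n → (Fin n → Bool) → Graph n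
switch G U = record
  { adj = switchAdj G U ; sym = switch-sym G U ; irrefl = switch-irrefl G U }

_≅_ : ∀ {m n} → Graph m → Graph n → Set
_≅_ {m} {n} G H =
  Σ (Fin m → Fin n) λ f → Σ (Fin n → Fin m) λ g →
    (∀ x → g (f x) ≡ x) × (∀ y → f (g y) ≡ y) ×
    (∀ i j → adj H (f i) (f j) ≡ adj G i j)

SwitchingEquivIso : ∀ {m n} → Graph m → Graph n → Set
SwitchingEquivIso {m} H G = ∃ λ (U : Fin m → Bool) → switch H U ≅ G

SDetermined : ∀ {n} → Graph n → Set
SDetermined G = ∀ {m} (H : Graph m) → SeidelCospectral H G → SwitchingEquivIso H G

-- Complete bipartite graph K_{p,q}: vertices 0..p-1 form one side,
-- p..p+q-1 the other.

inLeft : ∀ p {q} → Fin (p + q) → Bool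
inLeft p i = toℕ i <ᵇ p

K : ∀ p q → Graph (p + q)
K p q = record
  { adj = λ i j → inLeft p i xor inLeft p j
  ; sym = λ i j → xor-sym (inLeft p i) (inLeft p j)
  ; irrefl = λ i → xor-self (inLeft p i) }

module Submission where

-- For L : Fin n → Bool let A_L be the complete bipartite graph
-- whose parts are where L is true and where L is false (K p q is A_L for
-- L = inLeft p).  The proof compares coefficients of det(xI − S):
--  * Leibniz expansion: a permutation π with f fixed points contributes
--    sgn π · Π_{π i ≠ i} S(i, π i) = ±1 to the coefficient of x^f.  We index
--    permutations by the codes that the Laplace expansion of Defs runs
--    through, and identify the Laplace sign with the inversion sign.
--  * The coefficient of x^n is 1 and higher ones vanish: cospectral graphs
--    have the same order n.
--  * Permutations moving exactly three points are even 3-cycles.  For A_L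
--    each of them contributes −1, the least possible value, to the
--    coefficient of x^(n−3); so in a cospectral graph H each contributes −1
--    too, i.e. every triangle of H through vertex 0 has an even number of edges.
--  * Hence adj H i j = adj H 0 i xor adj H 0 j, and switching H with respect
--    to U v = adj H 0 v xor L v gives exactly A_L.

open import Defs hiding (sym)
open import Algebra.Bundles using (CommutativeMonoid; CommutativeRing)
import Algebra.Properties.CommutativeMonoid.Sum as MonoidSum
open import Data.Bool using (Bool; true; false; not; _∧_; _xor_; if_then_else_; T)
open import Data.Bool.Properties as BoolP
  using (xor-∧-commutativeRing; xor-same; xor-identityʳ; xor-assoc; xor-comm; xor-annihilates-not)
open import Data.Empty using (⊥-elim)
open import Data.Fin using (Fin; zero; suc; toℕ; punchIn; punchOut; _≟_)
open import Data.Fin.Permutation using (Permutation′; _⟨$⟩ʳ_; insert; remove; punchIn-permute)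
import Data.Fin.Permutation as Perm
open import Data.Fin.Properties using (punchInᵢ≢i; punchIn-injective; punchIn-punchOut; suc-injective; all?)
open import Data.Integer as ℤ using (ℤ; -_; _+_; _*_; _≤_; 0ℤ; 1ℤ; -1ℤ)
import Data.Integer.Properties as ℤP
open import Data.List using ([]; _∷_; map)
open import Data.Nat as ℕ using (ℕ; zero; suc; _<ᵇ_; _≥_)
import Data.Nat.Properties as ℕP
open import Data.Product using (Σ; _×_; _,_; proj₁; proj₂)
open import Data.Unit using (⊤; tt)
open import Function using (_∘_; id)
open import Relation.Binary.PropositionalEquality
  using (_≡_; _≢_; refl; sym; trans; cong; cong₂; subst; subst₂; module ≡-Reasoning)
open import Relation.Nullary using (¬_; Dec; does; yes; no)
open import Relation.Nullary.Decidable using (dec-true; dec-false; from-yes; ¬?; _→-dec_)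
open import Algebra.Properties.CommutativeSemigroup ℤP.+-commutativeSemigroup
  using () renaming (interchange to +-interchange)
open import Algebra.Properties.CommutativeSemigroup
  (CommutativeRing.+-commutativeSemigroup xor-∧-commutativeRing)
  using () renaming (interchange to xor-interchange)

module ℤSum = MonoidSum ℤP.+-0-commutativeMonoid
module ℕSum = MonoidSum ℕP.+-0-commutativeMonoid
module XorSum = MonoidSum (CommutativeRing.+-commutativeMonoid xor-∧-commutativeRing)

module SumSupport {c ℓ} (M : CommutativeMonoid c ℓ) where
  open CommutativeMonoid M
    using (Carrier; _≈_; ε; _∙_; ∙-congˡ; identityʳ; setoid; reflexive)
    renaming (trans to ≈-trans)
  open MonoidSum M using (sum; sum-cong-≋; sum-replicate-zero; sum-remove)
  open import Relation.Binary.Reasoning.Setoid setoid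

  sum-vanishing : ∀ {n} {f : Fin n → Carrier} → (∀ i → f i ≈ ε) → sum f ≈ ε
  sum-vanishing {n} vanish = ≈-trans (sum-cong-≋ vanish) (sum-replicate-zero n)

  sum-support₁ : ∀ {n} (f : Fin (suc n) → Carrier) x →
                 (∀ i → i ≢ x → f i ≈ ε) → sum f ≈ f x
  sum-support₁ f x vanish = begin
    sum f                      ≈⟨ sum-remove f ⟩
    f x ∙ sum (f ∘ punchIn x)  ≈⟨ ∙-congˡ (sum-vanishing (λ j → vanish _ (punchInᵢ≢i x j))) ⟩
    f x ∙ ε                    ≈⟨ identityʳ _ ⟩
    f x                        ∎

  private
    punchIn-avoids : ∀ {n} {x y : Fin (suc n)} (x≢y : x ≢ y) j →
                     j ≢ punchOut x≢y → punchIn x j ≢ y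
    punchIn-avoids {x = x} x≢y j j≢y′ e =
      j≢y′ (punchIn-injective x j _ (trans e (sym (punchIn-punchOut x≢y))))

  sum-support₂ : ∀ {n} (f : Fin (suc n) → Carrier) x y → x ≢ y →
                 (∀ i → i ≢ x → i ≢ y → f i ≈ ε) → sum f ≈ f x ∙ f y
  sum-support₂ {zero}  f zero zero x≢y _ = ⊥-elim (x≢y refl)
  sum-support₂ {suc n} f x y x≢y vanish = begin
    sum f                                ≈⟨ sum-remove f ⟩
    f x ∙ sum (f ∘ punchIn x)            ≈⟨ ∙-congˡ (sum-support₁ (f ∘ punchIn x) _ vanish′) ⟩
    f x ∙ f (punchIn x (punchOut x≢y))   ≈⟨ ∙-congˡ (reflexive (cong f (punchIn-punchOut x≢y))) ⟩
    f x ∙ f y                            ∎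
    where
    vanish′ : ∀ j → j ≢ punchOut x≢y → f (punchIn x j) ≈ ε
    vanish′ j j≢y′ = vanish _ (punchInᵢ≢i x j) (punchIn-avoids x≢y j j≢y′)

  sum-support₃ : ∀ {n} (f : Fin (suc n) → Carrier) x y z → x ≢ y → x ≢ z → y ≢ z →
                 (∀ i → i ≢ x → i ≢ y → i ≢ z → f i ≈ ε) → sum f ≈ f x ∙ (f y ∙ f z)
  sum-support₃ {zero}  f zero zero _ x≢y = ⊥-elim (x≢y refl)
  sum-support₃ {suc n} f x y z x≢y x≢z y≢z vanish = begin
    sum f                                    ≈⟨ sum-remove f ⟩
    f x ∙ sum (f ∘ punchIn x)                ≈⟨ ∙-congˡ (sum-support₂ (f ∘ punchIn x) _ _ y′≢z′ vanish′) ⟩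
    f x ∙ (f (punchIn x y′) ∙ f (punchIn x z′))
      ≈⟨ ∙-congˡ (reflexive (cong₂ (λ u v → f u ∙ f v) (punchIn-punchOut x≢y) (punchIn-punchOut x≢z))) ⟩
    f x ∙ (f y ∙ f z)                        ∎
    where
    y′ z′ : Fin (suc n)
    y′ = punchOut x≢y
    z′ = punchOut x≢z
    y′≢z′ : y′ ≢ z′
    y′≢z′ e = y≢z (trans (sym (punchIn-punchOut x≢y))
                  (trans (cong (punchIn x) e) (punchIn-punchOut x≢z)))
    vanish′ : ∀ j → j ≢ y′ → j ≢ z′ → f (punchIn x j) ≈ ε
    vanish′ j j≢y′ j≢z′ =
      vanish _ (punchInᵢ≢i x j) (punchIn-avoids x≢y j j≢y′) (punchIn-avoids x≢z j j≢z′)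

module ℤSupport   = SumSupport ℤP.+-0-commutativeMonoid
module XorSupport = SumSupport (CommutativeRing.+-commutativeMonoid xor-∧-commutativeRing)

-- Signs (−1)^b, counting and parity.

signed : Bool → ℤ → ℤ
signed true  x = - x
signed false x = x

signed-not : ∀ b x → signed (not b) x ≡ - signed b x
signed-not true  x = sym (ℤP.neg-involutive x)
signed-not false x = refl

signed-signed : ∀ a b x → signed a (signed b x) ≡ signed (a xor b) x
signed-signed true  true  x = ℤP.neg-involutive x
signed-signed true  false x = refl
signed-signed false b     x = refl

signed-one-* : ∀ a b → signed a 1ℤ * signed b 1ℤ ≡ signed (a xor b) 1ℤ
signed-one-* true  true  = refl
signed-one-* true  false = refl
signed-one-* false true  = refl
signed-one-* false false = refl

sum-neg : ∀ {n} (f : Fin n → ℤ) → ℤSum.sum (λ j → - f j) ≡ - ℤSum.sum f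
sum-neg {zero}  f = refl
sum-neg {suc n} f = trans (cong ((- f zero) +_) (sum-neg (f ∘ suc)))
                          (sym (ℤP.neg-distrib-+ (f zero) (ℤSum.sum (f ∘ suc))))

sum-signed : ∀ {n} b (f : Fin n → ℤ) → ℤSum.sum (λ j → signed b (f j)) ≡ signed b (ℤSum.sum f)
sum-signed true  f = sum-neg f
sum-signed false f = refl

indicator : ∀ {n} → (Fin n → Bool) → Fin n → ℕ
indicator b i = if b i then 1 else 0

count : ∀ {n} → (Fin n → Bool) → ℕ
count b = ℕSum.sum (indicator b)

odd : ℕ → Bool
odd zero    = false
odd (suc n) = not (odd n)

parity : ∀ {n} → (Fin n → Bool) → Bool
parity = XorSum.sum

parity≡odd-count : ∀ {n} (b : Fin n → Bool) → parity b ≡ odd (count b)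
parity≡odd-count {zero}  b = refl
parity≡odd-count {suc n} b with b zero
... | true  = cong not (parity≡odd-count (b ∘ suc))
... | false = parity≡odd-count (b ∘ suc)

count-≤ : ∀ {n} (b : Fin n → Bool) → count b ℕ.≤ n
count-≤ {zero}  b = ℕ.z≤n
count-≤ {suc n} b with b zero
... | true  = ℕ.s≤s (count-≤ (b ∘ suc))
... | false = ℕP.m≤n⇒m≤1+n (count-≤ (b ∘ suc))

count-complement : ∀ {n} (b : Fin n → Bool) → count b ℕ.+ count (not ∘ b) ≡ n
count-complement {zero}  b = refl
count-complement {suc n} b with b zero
... | true  = cong suc (count-complement (b ∘ suc))
... | false = trans (ℕP.+-suc _ _) (cong suc (count-complement (b ∘ suc)))

count-witness : ∀ {n k} (b : Fin n → Bool) → count b ≡ suc k → Σ (Fin n) λ l → b l ≡ true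
count-witness {suc n} b e with b zero in b₀
... | true  = zero , b₀
... | false with count-witness (b ∘ suc) e
...   | l , bl = suc l , bl

-- Polynomials are handled through their coefficient sequences.

_≈P_ : Poly → Poly → Set
p ≈P q = ∀ t → coeff p t ≡ coeff q t

coeff-+P : ∀ p q k → coeff (p +P q) k ≡ coeff p k + coeff q k
coeff-+P []      q       k       = sym (ℤP.+-identityˡ _)
coeff-+P (a ∷ p) []      k       = sym (ℤP.+-identityʳ _)
coeff-+P (a ∷ p) (b ∷ q) zero    = refl
coeff-+P (a ∷ p) (b ∷ q) (suc k) = coeff-+P p q k

coeff-neg : ∀ p k → coeff (-P p) k ≡ - coeff p k
coeff-neg []      k       = refl
coeff-neg (a ∷ p) zero    = refl
coeff-neg (a ∷ p) (suc k) = coeff-neg p k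

coeff-scale : ∀ a q k → coeff (map (a *_) q) k ≡ a * coeff q k
coeff-scale a []      k       = sym (ℤP.*-zeroʳ a)
coeff-scale a (b ∷ q) zero    = refl
coeff-scale a (b ∷ q) (suc k) = coeff-scale a q k

-- conv p g k = Σ_{t ≤ k} p_t · g (k − t), the k-th coefficient of p
-- times the power series with coefficients g.
conv : Poly → (ℕ → ℤ) → ℕ → ℤ
conv []      g k       = 0ℤ
conv (a ∷ p) g zero    = a * g zero
conv (a ∷ p) g (suc k) = a * g (suc k) + conv p g k

coeff-*P : ∀ p q k → coeff (p *P q) k ≡ conv p (coeff q) k
coeff-*P []      q k       = refl
coeff-*P (a ∷ p) q zero    =
  trans (coeff-+P (map (a *_) q) _ zero) (trans (ℤP.+-identityʳ _) (coeff-scale a q zero))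
coeff-*P (a ∷ p) q (suc k) =
  trans (coeff-+P (map (a *_) q) _ (suc k)) (cong₂ _+_ (coeff-scale a q (suc k)) (coeff-*P p q k))

conv-vanishing : ∀ p g → (∀ t → coeff p t ≡ 0ℤ) → ∀ k → conv p g k ≡ 0ℤ
conv-vanishing []      g vanish k       = refl
conv-vanishing (a ∷ p) g vanish zero    = cong (_* g zero) (vanish zero)
conv-vanishing (a ∷ p) g vanish (suc k) =
  cong₂ _+_ (cong (_* g (suc k)) (vanish zero)) (conv-vanishing p g (vanish ∘ suc) k)

conv-≈P : ∀ p q g → p ≈P q → ∀ k → conv p g k ≡ conv q g k
conv-≈P []      q       g p≈q k       = sym (conv-vanishing q g (sym ∘ p≈q) k)
conv-≈P (a ∷ p) []      g p≈q k       = conv-vanishing (a ∷ p) g p≈q k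
conv-≈P (a ∷ p) (b ∷ q) g p≈q zero    = cong (_* g zero) (p≈q zero)
conv-≈P (a ∷ p) (b ∷ q) g p≈q (suc k) =
  cong₂ _+_ (cong (_* g (suc k)) (p≈q zero)) (conv-≈P p q g (p≈q ∘ suc) k)

conv-cong : ∀ p {g h : ℕ → ℤ} → (∀ i → g i ≡ h i) → ∀ k → conv p g k ≡ conv p h k
conv-cong []      g≡h k       = refl
conv-cong (a ∷ p) g≡h zero    = cong (a *_) (g≡h zero)
conv-cong (a ∷ p) g≡h (suc k) = cong₂ _+_ (cong (a *_) (g≡h (suc k))) (conv-cong p g≡h k)

conv-neg : ∀ p (g : ℕ → ℤ) k → conv p (λ i → - g i) k ≡ - conv p g k
conv-neg []      g k       = refl
conv-neg (a ∷ p) g zero    = sym (ℤP.neg-distribʳ-* a (g zero))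
conv-neg (a ∷ p) g (suc k) = begin
  a * - g (suc k) + conv p (λ i → - g i) k  ≡⟨ cong₂ _+_ (sym (ℤP.neg-distribʳ-* a _)) (conv-neg p g k) ⟩
  - (a * g (suc k)) + - conv p g k          ≡⟨ sym (ℤP.neg-distrib-+ (a * g (suc k)) (conv p g k)) ⟩
  - (a * g (suc k) + conv p g k)            ∎
  where open ≡-Reasoning

conv-signed : ∀ p b (g : ℕ → ℤ) k → conv p (λ i → signed b (g i)) k ≡ signed b (conv p g k)
conv-signed p true  g k = conv-neg p g k
conv-signed p false g k = refl

conv-+ : ∀ p (g h : ℕ → ℤ) k → conv p (λ i → g i + h i) k ≡ conv p g k + conv p h k
conv-+ []      g h k       = refl
conv-+ (a ∷ p) g h zero    = ℤP.*-distribˡ-+ a (g zero) (h zero)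
conv-+ (a ∷ p) g h (suc k) =
  trans (cong₂ _+_ (ℤP.*-distribˡ-+ a _ _) (conv-+ p g h k))
        (+-interchange (a * g (suc k)) (a * h (suc k)) (conv p g k) (conv p h k))

conv-zero : ∀ p k → conv p (λ _ → 0ℤ) k ≡ 0ℤ
conv-zero []      k       = refl
conv-zero (a ∷ p) zero    = ℤP.*-zeroʳ a
conv-zero (a ∷ p) (suc k) = cong₂ _+_ (ℤP.*-zeroʳ a) (conv-zero p k)

conv-sum : ∀ p {n} (G : Fin n → ℕ → ℤ) k →
           conv p (λ i → ℤSum.sum (λ j → G j i)) k ≡ ℤSum.sum (λ j → conv p (G j) k)
conv-sum p {zero}  G k = conv-zero p k
conv-sum p {suc n} G k =
  trans (conv-+ p (G zero) _ k) (cong (conv p (G zero) k +_) (conv-sum p (G ∘ suc) k))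

-- The Laplace determinant of Defs, expanded into a sum over permutations.

-- Codes of permutations, matching the Laplace expansion along the first
-- row: the column chosen for row 0, followed by a code for the minor.
Code : ℕ → Set
Code zero    = ⊤
Code (suc n) = Fin (suc n) × Code n

permutation-injective : ∀ {n} (π : Permutation′ n) {x y} → π ⟨$⟩ʳ x ≡ π ⟨$⟩ʳ y → x ≡ y
permutation-injective π {x} {y} πx≡πy =
  trans (sym (Perm.inverseˡ π)) (trans (cong (π Perm.⟨$⟩ˡ_) πx≡πy) (Perm.inverseˡ π))

-- The permutation of a code: row 0 goes to column j and the permutation
-- of the minor is re-indexed around j.
perm : ∀ {n} → Code n → Permutation′ n
perm {zero}  _       = Perm.id
perm {suc n} (j , c) = insert zero j (perm c)

-- The sign collected by the Laplace expansion: column j contributes (−1)^j.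
codeParity : ∀ {n} → Code n → Bool
codeParity {zero}  _       = false
codeParity {suc n} (j , c) = odd (toℕ j) xor codeParity c

sumCodes : ∀ {n} → (Code n → ℤ) → ℤ
sumCodes {zero}  f = f tt
sumCodes {suc n} f = ℤSum.sum (λ j → sumCodes (λ c → f (j , c)))

sumCodes-cong : ∀ {n} {f g : Code n → ℤ} → (∀ c → f c ≡ g c) → sumCodes f ≡ sumCodes g
sumCodes-cong {zero}  f≡g = f≡g tt
sumCodes-cong {suc n} f≡g = ℤSum.sum-cong-≗ (λ j → sumCodes-cong (λ c → f≡g (j , c)))

sumCodes-signed : ∀ {n} b (f : Code n → ℤ) →
                  sumCodes (λ c → signed b (f c)) ≡ signed b (sumCodes f)
sumCodes-signed {zero}  b f = refl
sumCodes-signed {suc n} b f =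
  trans (ℤSum.sum-cong-≗ (λ j → sumCodes-signed b (λ c → f (j , c))))
        (sum-signed b (λ j → sumCodes (λ c → f (j , c))))

conv-sumCodes : ∀ p {n} (G : Code n → ℕ → ℤ) k →
                conv p (λ i → sumCodes (λ c → G c i)) k ≡ sumCodes (λ c → conv p (G c) k)
conv-sumCodes p {zero}  G k = refl
conv-sumCodes p {suc n} G k =
  trans (conv-sum p (λ j i → sumCodes (λ c → G (j , c) i)) k)
        (ℤSum.sum-cong-≗ (λ j → conv-sumCodes p (λ c → G (j , c)) k))

prodP : ∀ {n} → (Fin n → Poly) → Poly
prodP {zero}  g = oneP
prodP {suc n} g = g zero *P prodP (g ∘ suc)

altSum-coeff : ∀ {n} (f : Fin n → Poly) k →
               coeff (altSum f) k ≡ ℤSum.sum (λ j → signed (odd (toℕ j)) (coeff (f j) k))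
altSum-coeff {zero}  f k = refl
altSum-coeff {suc n} f k = begin
  coeff (f zero +P (-P altSum (f ∘ suc))) k
    ≡⟨ coeff-+P (f zero) _ k ⟩
  coeff (f zero) k + coeff (-P altSum (f ∘ suc)) k
    ≡⟨ cong (coeff (f zero) k +_) (trans (coeff-neg (altSum (f ∘ suc)) k)
                                         (cong -_ (altSum-coeff (f ∘ suc) k))) ⟩
  coeff (f zero) k + - ℤSum.sum (λ j → signed (odd (toℕ j)) (coeff (f (suc j)) k))
    ≡⟨ cong (coeff (f zero) k +_) (sym (sum-neg (λ j → signed (odd (toℕ j)) (coeff (f (suc j)) k)))) ⟩
  coeff (f zero) k + ℤSum.sum (λ j → - signed (odd (toℕ j)) (coeff (f (suc j)) k))
    ≡⟨ cong (coeff (f zero) k +_)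
            (ℤSum.sum-cong-≗ (λ j → sym (signed-not (odd (toℕ j)) (coeff (f (suc j)) k)))) ⟩
  ℤSum.sum (λ j → signed (odd (toℕ j)) (coeff (f j) k))
    ∎
  where open ≡-Reasoning

leibniz : ∀ {n} (M : Fin n → Fin n → Poly) k →
          coeff (det M) k ≡
          sumCodes (λ c → signed (codeParity c) (coeff (prodP (λ i → M i (perm c ⟨$⟩ʳ i))) k))
leibniz {zero}  M k = refl
leibniz {suc n} M k =
  trans (altSum-coeff (λ j → M zero j *P det (minor j)) k) (ℤSum.sum-cong-≗ expand-row)
  where
  minor : Fin (suc n) → Fin n → Fin n → Poly
  minor j i l = M (suc i) (punchIn j l)

  diagonal : Fin (suc n) → Code n → Poly
  diagonal j c = prodP (λ i → minor j i (perm c ⟨$⟩ʳ i))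

  expand-row : ∀ j →
    signed (odd (toℕ j)) (coeff (M zero j *P det (minor j)) k) ≡
    sumCodes (λ c → signed (odd (toℕ j) xor codeParity c) (coeff (M zero j *P diagonal j c) k))
  expand-row j = begin
    signed s (coeff (M zero j *P det (minor j)) k)
      ≡⟨ cong (signed s) (coeff-*P (M zero j) (det (minor j)) k) ⟩
    signed s (conv (M zero j) (coeff (det (minor j))) k)
      ≡⟨ cong (signed s) (conv-cong (M zero j) (leibniz (minor j)) k) ⟩
    signed s (conv (M zero j) (λ i → sumCodes (λ c → signed (codeParity c) (coeff (diagonal j c) i))) k)
      ≡⟨ cong (signed s) (conv-sumCodes (M zero j) (λ c i → signed (codeParity c) (coeff (diagonal j c) i)) k) ⟩
    signed s (sumCodes (λ c → conv (M zero j) (λ i → signed (codeParity c) (coeff (diagonal j c) i)) k))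
      ≡⟨ cong (signed s) (sumCodes-cong (λ c → conv-signed (M zero j) (codeParity c) (coeff (diagonal j c)) k)) ⟩
    signed s (sumCodes (λ c → signed (codeParity c) (conv (M zero j) (coeff (diagonal j c)) k)))
      ≡⟨ cong (signed s) (sumCodes-cong (λ c → cong (signed (codeParity c))
                                                     (sym (coeff-*P (M zero j) (diagonal j c) k)))) ⟩
    signed s (sumCodes (λ c → signed (codeParity c) (coeff (M zero j *P diagonal j c) k)))
      ≡⟨ sym (sumCodes-signed s (λ c → signed (codeParity c) (coeff (M zero j *P diagonal j c) k))) ⟩
    sumCodes (λ c → signed s (signed (codeParity c) (coeff (M zero j *P diagonal j c) k)))
      ≡⟨ sumCodes-cong (λ c → signed-signed s (codeParity c) (coeff (M zero j *P diagonal j c) k)) ⟩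
    sumCodes (λ c → signed (s xor codeParity c) (coeff (M zero j *P diagonal j c) k))
      ∎
    where
    open ≡-Reasoning
    s : Bool
    s = odd (toℕ j)

-- The coefficients of the Seidel characteristic polynomial.

-- The entries of xI − S(G): x on the diagonal, the constant (−1)^β off it.
factor : Bool → Bool → Poly
factor true  _ = 0ℤ ∷ 1ℤ ∷ []
factor false β = signed β 1ℤ ∷ []

signedMonomial : ℕ → Bool → ℕ → ℤ
signedMonomial d s k = if k ℕ.≡ᵇ d then signed s 1ℤ else 0ℤ

signed-signedMonomial : ∀ a d s k → signed a (signedMonomial d s k) ≡ signedMonomial d (a xor s) k
signed-signedMonomial a     d s k with k ℕ.≡ᵇ d
signed-signedMonomial a     d s k | true  = signed-signed a s 1ℤ
signed-signedMonomial true  d s k | false = refl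
signed-signedMonomial false d s k | false = refl

conv-constant : ∀ a g k → conv (a ∷ []) g k ≡ a * g k
conv-constant a g zero    = refl
conv-constant a g (suc k) = ℤP.+-identityʳ (a * g (suc k))

conv-factor : ∀ b β d s k →
              conv (factor b β) (signedMonomial d s) k ≡
              signedMonomial ((if b then 1 else 0) ℕ.+ d) ((not b ∧ β) xor s) k
conv-factor true  β d s zero    = refl
conv-factor true  β d s (suc k) =
  trans (ℤP.+-identityˡ _) (trans (conv-constant 1ℤ _ k) (ℤP.*-identityˡ _))
conv-factor false β d s k       =
  trans (conv-constant (signed β 1ℤ) (signedMonomial d s) k) (scale (k ℕ.≡ᵇ d))
  where
  scale : ∀ e → signed β 1ℤ * (if e then signed s 1ℤ else 0ℤ) ≡ (if e then signed (β xor s) 1ℤ else 0ℤ)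
  scale true  = signed-one-* β s
  scale false = ℤP.*-zeroʳ (signed β 1ℤ)

product-of-factors : ∀ {n} (g : Fin n → Poly) (b β : Fin n → Bool) →
                     (∀ i → g i ≈P factor (b i) (β i)) → ∀ k →
                     coeff (prodP g) k ≡ signedMonomial (count b) (parity (λ i → not (b i) ∧ β i)) k
product-of-factors {zero}  g b β g≈ zero    = refl
product-of-factors {zero}  g b β g≈ (suc k) = refl
product-of-factors {suc n} g b β g≈ k = begin
  coeff (g zero *P prodP (g ∘ suc)) k
    ≡⟨ coeff-*P (g zero) (prodP (g ∘ suc)) k ⟩
  conv (g zero) (coeff (prodP (g ∘ suc))) k
    ≡⟨ conv-≈P (g zero) (factor (b zero) (β zero)) (coeff (prodP (g ∘ suc))) (g≈ zero) k ⟩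
  conv (factor (b zero) (β zero)) (coeff (prodP (g ∘ suc))) k
    ≡⟨ conv-cong (factor (b zero) (β zero)) (product-of-factors (g ∘ suc) (b ∘ suc) (β ∘ suc) (g≈ ∘ suc)) k ⟩
  conv (factor (b zero) (β zero)) (signedMonomial (count (b ∘ suc)) (parity (λ i → not (b (suc i)) ∧ β (suc i)))) k
    ≡⟨ conv-factor (b zero) (β zero) _ _ k ⟩
  signedMonomial (count b) (parity (λ i → not (b i) ∧ β i)) k
    ∎
  where open ≡-Reasoning

-- Defs builds the matrix xI − S locally inside charPoly; this exposes it.
charMatrix : ∀ {n} (S : Fin n → Fin n → ℤ) → Σ (Fin n → Fin n → Poly) λ M → charPoly S ≡ det M
charMatrix S = _ , refl

seidel-entry : ∀ {n} (G : Graph n) i j →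
               proj₁ (charMatrix (SeidelMatrix G)) i j ≈P factor (does (i ≟ j)) (not (adj G i j))
seidel-entry G i j t with i ≟ j
... | yes i≡j with i ≟ j
...   | yes _   = refl
...   | no  i≢j = ⊥-elim (i≢j i≡j)
seidel-entry G i j t | no i≢j with i ≟ j
...   | yes i≡j = ⊥-elim (i≢j i≡j)
...   | no  _ with adj G i j
...     | true  = refl
...     | false = refl

fixedᵇ : ∀ {n} → (Fin n → Fin n) → Fin n → Bool
fixedᵇ π i = does (i ≟ π i)

fixedPoints : ∀ {n} → Code n → ℕ
fixedPoints c = count (fixedᵇ (perm c ⟨$⟩ʳ_))

movedᵇ : ∀ {n} → (Fin n → Fin n) → Fin n → Bool
movedᵇ f i = not (fixedᵇ f i)

weight : ∀ {n} → (Fin n → Fin n → Bool) → (Fin n → Fin n) → Bool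
weight A f = parity (λ i → movedᵇ f i ∧ not (A i (f i)))

weight-cong : ∀ {n} (A : Fin n → Fin n → Bool) {f g : Fin n → Fin n} → (∀ i → f i ≡ g i) →
              weight A f ≡ weight A g
weight-cong A f≡g = XorSum.sum-cong-≗ (λ i → cong (λ j → not (does (i ≟ j)) ∧ not (A i j)) (f≡g i))

term : ∀ {n} → (Fin n → Fin n → Bool) → ℕ → Code n → ℤ
term A k c = signedMonomial (fixedPoints c) (codeParity c xor weight A (perm c ⟨$⟩ʳ_)) k

seidel-coeff : ∀ {n} (G : Graph n) k →
               coeff (charPoly (SeidelMatrix G)) k ≡ sumCodes (term (adj G) k)
seidel-coeff G k =
  trans (leibniz (proj₁ (charMatrix (SeidelMatrix G))) k) (sumCodes-cong contribution)
  where
  contribution : ∀ c → signed (codeParity c)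
                   (coeff (prodP (λ i → proj₁ (charMatrix (SeidelMatrix G)) i (perm c ⟨$⟩ʳ i))) k)
                 ≡ term (adj G) k c
  contribution c = trans
    (cong (signed (codeParity c))
          (product-of-factors _ (fixedᵇ π) (λ i → not (adj G i (π i))) (λ i → seidel-entry G i (π i)) k))
    (signed-signedMonomial (codeParity c) (fixedPoints c) (weight (adj G) π) k)
    where
    π : Fin _ → Fin _
    π = perm c ⟨$⟩ʳ_

-- The leading coefficients: cospectral graphs have the same order.


sumCodes-vanishing : ∀ {n} {f : Code n → ℤ} → (∀ c → f c ≡ 0ℤ) → sumCodes f ≡ 0ℤ
sumCodes-vanishing {zero}  vanish = vanish tt
sumCodes-vanishing {suc n} vanish =
  ℤSupport.sum-vanishing (λ j → sumCodes-vanishing (λ c → vanish (j , c)))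

term-off : ∀ {n} A k (c : Code n) → k ≢ fixedPoints c → term A k c ≡ 0ℤ
term-off A k c k≢d with k ℕ.≡ᵇ fixedPoints c in k≡ᵇd
... | true  = ⊥-elim (k≢d (ℕP.≡ᵇ⇒≡ k _ (subst T (sym k≡ᵇd) tt)))
... | false = refl

coefficient-beyond-degree : ∀ {n} A k → n ℕ.< k → sumCodes {n} (term A k) ≡ 0ℤ
coefficient-beyond-degree A k n<k = sumCodes-vanishing (λ c →
  term-off A k c (ℕP.>⇒≢ (ℕP.≤-<-trans (count-≤ (fixedᵇ (perm c ⟨$⟩ʳ_))) n<k)))

-- ... and is monic: only the identity code fixes all n points.
leading-coefficient : ∀ {n} A → sumCodes {n} (term A n) ≡ 1ℤ
leading-coefficient {zero}  A = refl
leading-coefficient {suc n} A =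
  cong₂ _+_ (leading-coefficient (λ i j → A (suc i) (suc j)))
            (ℤSupport.sum-vanishing (λ j → sumCodes-vanishing (λ c → moves-zero j c)))
  where
  -- codes sending 0 to suc j fix at most n points
  moves-zero : ∀ j c → term A (suc n) (suc j , c) ≡ 0ℤ
  moves-zero j c = term-off A (suc n) (suc j , c)
    (ℕP.>⇒≢ (ℕ.s≤s (count-≤ (λ i → fixedᵇ (perm (suc j , c) ⟨$⟩ʳ_) (suc i)))))

-- A graph cannot have the Seidel coefficients of a larger graph: the
-- coefficient of x^n would be 0 for the one and 1 for the other.
not-smaller : ∀ {m n} (A : Fin m → Fin m → Bool) (B : Fin n → Fin n → Bool) →
              (∀ k → sumCodes (term A k) ≡ sumCodes (term B k)) → ¬ (m ℕ.< n)
not-smaller {n = n} A B same-coeff m<n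
  with trans (sym (coefficient-beyond-degree A n m<n)) (trans (same-coeff n) (leading-coefficient B))
... | ()

same-order : ∀ {m n} (A : Fin m → Fin m → Bool) (B : Fin n → Fin n → Bool) →
             (∀ k → sumCodes (term A k) ≡ sumCodes (term B k)) → m ≡ n
same-order A B same-coeff =
  ℕP.≤-antisym (ℕP.≮⇒≥ (not-smaller B A (sym ∘ same-coeff))) (ℕP.≮⇒≥ (not-smaller A B same-coeff))

-- The Laplace sign is the inversion sign, and 3-cycles are even.

ltᵇ : ∀ {m n} → Fin m → Fin n → Bool
ltᵇ x y = toℕ x <ᵇ toℕ y

pairParity : ∀ {n} → (Fin n → Fin n → Bool) → Bool
pairParity {zero}  Q = false
pairParity {suc n} Q = parity (λ y → Q zero (suc y)) xor pairParity (λ x y → Q (suc x) (suc y))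

pairParity-cong : ∀ {n} {Q R : Fin n → Fin n → Bool} → (∀ x y → Q x y ≡ R x y) →
                  pairParity Q ≡ pairParity R
pairParity-cong {zero}  Q≡R = refl
pairParity-cong {suc n} Q≡R =
  cong₂ _xor_ (XorSum.sum-cong-≗ (λ y → Q≡R zero (suc y))) (pairParity-cong (λ x y → Q≡R (suc x) (suc y)))

pairParity-remove : ∀ {n} (Q : Fin (suc n) → Fin (suc n) → Bool) → (∀ x y → Q x y ≡ Q y x) → ∀ l →
                    pairParity Q ≡
                    parity (λ y → Q l (punchIn l y)) xor pairParity (λ x y → Q (punchIn l x) (punchIn l y))
pairParity-remove Q Q-sym zero = refl
pairParity-remove {suc n} Q Q-sym (suc l) = begin
  parity (λ y → Q zero (suc y)) xor pairParity (λ x y → Q (suc x) (suc y))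
    ≡⟨ cong₂ _xor_ (XorSum.sum-remove {i = l} (λ y → Q zero (suc y)))
                   (pairParity-remove (λ x y → Q (suc x) (suc y)) (λ x y → Q-sym (suc x) (suc y)) l) ⟩
  (Q zero (suc l) xor a) xor (b xor c)
    ≡⟨ xor-interchange (Q zero (suc l)) a b c ⟩
  (Q zero (suc l) xor b) xor (a xor c)
    ≡⟨ cong (λ q → (q xor b) xor (a xor c)) (Q-sym zero (suc l)) ⟩
  (Q (suc l) zero xor b) xor (a xor c)
    ∎
  where
  open ≡-Reasoning
  a b c : Bool
  a = parity (λ y → Q zero (suc (punchIn l y)))
  b = parity (λ y → Q (suc l) (suc (punchIn l y)))
  c = pairParity (λ x y → Q (suc (punchIn l x)) (suc (punchIn l y)))

inverted : ∀ {n} → (Fin n → Fin n) → Fin n → Fin n → Bool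
inverted π x y = ltᵇ x y xor ltᵇ (π x) (π y)

inversionParity : ∀ {n} → (Fin n → Fin n) → Bool
inversionParity π = pairParity (inverted π)

ltᵇ-punchIn : ∀ {n} (j : Fin (suc n)) (x y : Fin n) → ltᵇ (punchIn j x) (punchIn j y) ≡ ltᵇ x y
ltᵇ-punchIn zero    x       y       = refl
ltᵇ-punchIn (suc j) zero    zero    = refl
ltᵇ-punchIn (suc j) zero    (suc y) = refl
ltᵇ-punchIn (suc j) (suc x) zero    = refl
ltᵇ-punchIn (suc j) (suc x) (suc y) = ltᵇ-punchIn j x y

ltᵇ-pivot : ∀ {n} (j : Fin (suc n)) (y : Fin n) → not (ltᵇ j (punchIn j y)) ≡ ltᵇ y j
ltᵇ-pivot zero    y       = refl
ltᵇ-pivot (suc j) zero    = refl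
ltᵇ-pivot (suc j) (suc y) = ltᵇ-pivot j y

ltᵇ-flip : ∀ {n} (x y : Fin n) → x ≢ y → ltᵇ y x ≡ not (ltᵇ x y)
ltᵇ-flip zero    zero    x≢y = ⊥-elim (x≢y refl)
ltᵇ-flip zero    (suc y) x≢y = refl
ltᵇ-flip (suc x) zero    x≢y = refl
ltᵇ-flip (suc x) (suc y) x≢y = ltᵇ-flip x y (x≢y ∘ cong suc)

parity-below : ∀ {n} (j : Fin (suc n)) → parity {n} (λ y → ltᵇ y j) ≡ odd (toℕ j)
parity-below {n}     zero    = XorSupport.sum-vanishing {n} (λ _ → refl)
parity-below {suc n} (suc j) = cong not (parity-below j)

inverted-sym : ∀ {n} (π : Permutation′ n) x y → inverted (π ⟨$⟩ʳ_) x y ≡ inverted (π ⟨$⟩ʳ_) y x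
inverted-sym π x y with x ≟ y
... | yes refl = refl
... | no  x≢y  = sym (trans
  (cong₂ _xor_ (ltᵇ-flip x y x≢y) (ltᵇ-flip (π ⟨$⟩ʳ x) (π ⟨$⟩ʳ y) (x≢y ∘ permutation-injective π)))
  (xor-annihilates-not (ltᵇ x y) _))

parity-permute : ∀ {n} (f : Fin n → Bool) (π : Permutation′ n) → parity (λ i → f (π ⟨$⟩ʳ i)) ≡ parity f
parity-permute f π = sym (XorSum.sum-permute f π)

codeParity≡inversionParity : ∀ {n} (c : Code n) → codeParity c ≡ inversionParity (perm c ⟨$⟩ʳ_)
codeParity≡inversionParity {zero}  c       = refl
codeParity≡inversionParity {suc n} (j , c) = cong₂ _xor_ first-row minor
  where
  π : Fin n → Fin n
  π = perm c ⟨$⟩ʳ_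
  first-row : odd (toℕ j) ≡ parity (λ y → not (ltᵇ j (punchIn j (π y))))
  first-row = sym (begin
    parity (λ y → not (ltᵇ j (punchIn j (π y))))  ≡⟨ XorSum.sum-cong-≗ (λ y → ltᵇ-pivot j (π y)) ⟩
    parity (λ y → ltᵇ (π y) j)                     ≡⟨ parity-permute (λ y → ltᵇ y j) (perm c) ⟩
    parity {n} (λ y → ltᵇ y j)                     ≡⟨ parity-below j ⟩
    odd (toℕ j)                                    ∎)
    where open ≡-Reasoning
  minor : codeParity c ≡ pairParity (λ x y → inverted (perm (j , c) ⟨$⟩ʳ_) (suc x) (suc y))
  minor = trans (codeParity≡inversionParity c)
                (pairParity-cong (λ x y → cong (ltᵇ x y xor_) (sym (ltᵇ-punchIn j (π x) (π y)))))

does-punchIn : ∀ {n} (l : Fin (suc n)) (x y : Fin n) → does (punchIn l x ≟ punchIn l y) ≡ does (x ≟ y)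
does-punchIn l x y with x ≟ y
... | yes refl = dec-true (punchIn l x ≟ punchIn l x) refl
... | no  x≢y  = dec-false (punchIn l x ≟ punchIn l y) (x≢y ∘ punchIn-injective l x y)

module RemoveFixedPoint {n} (π : Permutation′ (suc n)) (l : Fin (suc n)) (πl≡l : π ⟨$⟩ʳ l ≡ l) where
  π′ : Permutation′ n
  π′ = remove l π

  shift : ∀ y → π ⟨$⟩ʳ punchIn l y ≡ punchIn l (π′ ⟨$⟩ʳ y)
  shift y = trans (punchIn-permute π l y) (cong (λ z → punchIn z (π′ ⟨$⟩ʳ y)) πl≡l)

  fixed-count : count (fixedᵇ (π ⟨$⟩ʳ_)) ≡ suc (count (fixedᵇ (π′ ⟨$⟩ʳ_)))
  fixed-count = trans (ℕSum.sum-remove {i = l} (indicator (fixedᵇ (π ⟨$⟩ʳ_))))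
                      (cong₂ ℕ._+_ l-fixed (ℕSum.sum-cong-≗ others-fixed))
    where
    l-fixed : indicator (fixedᵇ (π ⟨$⟩ʳ_)) l ≡ 1
    l-fixed = cong (λ b → if b then 1 else 0) (dec-true (l ≟ π ⟨$⟩ʳ l) (sym πl≡l))
    others-fixed : ∀ y → indicator (fixedᵇ (π ⟨$⟩ʳ_)) (punchIn l y) ≡ indicator (fixedᵇ (π′ ⟨$⟩ʳ_)) y
    others-fixed y = cong (λ b → if b then 1 else 0)
      (trans (cong (λ z → does (punchIn l y ≟ z)) (shift y)) (does-punchIn l y (π′ ⟨$⟩ʳ y)))

  inversions : inversionParity (π ⟨$⟩ʳ_) ≡ inversionParity (π′ ⟨$⟩ʳ_)
  inversions = begin
    pairParity (inverted (π ⟨$⟩ʳ_))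
      ≡⟨ pairParity-remove (inverted (π ⟨$⟩ʳ_)) (inverted-sym π) l ⟩
    parity (λ y → inverted (π ⟨$⟩ʳ_) l (punchIn l y)) xor
      pairParity (λ x y → inverted (π ⟨$⟩ʳ_) (punchIn l x) (punchIn l y))
      ≡⟨ cong₂ _xor_ pairs-through-l (pairParity-cong other-pairs) ⟩
    pairParity (inverted (π′ ⟨$⟩ʳ_))
      ∎
    where
    open ≡-Reasoning
    -- the pairs through l: l is fixed, so π permutes the points before l
    below : Fin (suc n) → Bool
    below = ltᵇ l
    pairs-through-l : parity (λ y → inverted (π ⟨$⟩ʳ_) l (punchIn l y)) ≡ false
    pairs-through-l = begin
      parity (λ y → below (punchIn l y) xor ltᵇ (π ⟨$⟩ʳ l) (π ⟨$⟩ʳ punchIn l y))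
        ≡⟨ XorSum.sum-cong-≗ (λ y →
             cong (λ z → below (punchIn l y) xor ltᵇ z (π ⟨$⟩ʳ punchIn l y)) πl≡l) ⟩
      parity (λ y → below (punchIn l y) xor below (π ⟨$⟩ʳ punchIn l y))
        ≡⟨ XorSum.∑-distrib-+ (below ∘ punchIn l) (λ y → below (π ⟨$⟩ʳ punchIn l y)) ⟩
      parity (below ∘ punchIn l) xor parity (λ y → below (π ⟨$⟩ʳ punchIn l y))
        ≡⟨ cong (parity (below ∘ punchIn l) xor_)
                (trans (XorSum.sum-cong-≗ (cong below ∘ shift)) (parity-permute (below ∘ punchIn l) π′)) ⟩
      parity (below ∘ punchIn l) xor parity (below ∘ punchIn l)
        ≡⟨ xor-same (parity (below ∘ punchIn l)) ⟩
      false
        ∎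
    other-pairs : ∀ x y → inverted (π ⟨$⟩ʳ_) (punchIn l x) (punchIn l y) ≡ inverted (π′ ⟨$⟩ʳ_) x y
    other-pairs x y = cong₂ _xor_ (ltᵇ-punchIn l x y)
      (trans (cong₂ ltᵇ (shift x) (shift y)) (ltᵇ-punchIn l (π′ ⟨$⟩ʳ x) (π′ ⟨$⟩ʳ y)))

fixedᵇ-true : ∀ {n} (f : Fin n → Fin n) l → fixedᵇ f l ≡ true → f l ≡ l
fixedᵇ-true f l l-fixed with l ≟ f l
fixedᵇ-true f l l-fixed | yes l≡fl = sym l≡fl
fixedᵇ-true f l ()      | no  _

fixedPoints-cong : ∀ {n} {f g : Fin n → Fin n} → (∀ i → f i ≡ g i) → count (fixedᵇ f) ≡ count (fixedᵇ g)
fixedPoints-cong f≡g = ℕSum.sum-cong-≗ (λ i → cong (λ z → if does (i ≟ z) then 1 else 0) (f≡g i))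

inversionParity-cong : ∀ {n} {f g : Fin n → Fin n} → (∀ i → f i ≡ g i) → inversionParity f ≡ inversionParity g
inversionParity-cong f≡g = pairParity-cong (λ x y → cong₂ (λ u v → ltᵇ x y xor ltᵇ u v) (f≡g x) (f≡g y))

table : Fin 3 → Fin 3 → Fin 3 → Fin 3 → Fin 3
table a b c zero             = a
table a b c (suc zero)       = b
table a b c (suc (suc zero)) = c

as-table : (f : Fin 3 → Fin 3) → ∀ i → f i ≡ table (f zero) (f (suc zero)) (f (suc (suc zero))) i
as-table f zero             = refl
as-table f (suc zero)       = refl
as-table f (suc (suc zero)) = refl

-- The fixed-point-free injective maps of Fin 3, namely the two 3-cycles,
-- are even; decided by running through all 27 maps.
fixed-point-free-Fin3-even : ∀ a b c → a ≢ b → a ≢ c → b ≢ c →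
                             count (fixedᵇ (table a b c)) ≡ 0 → inversionParity (table a b c) ≡ false
fixed-point-free-Fin3-even = from-yes (all? λ a → all? λ b → all? λ c →
  ¬? (a ≟ b) →-dec ¬? (a ≟ c) →-dec ¬? (b ≟ c) →-dec
  count (fixedᵇ (table a b c)) ℕ.≟ 0 →-dec inversionParity (table a b c) BoolP.≟ false)

-- A permutation moving exactly three points is even: delete fixed points
-- until only the three moved points are left.
three-moved-even : ∀ m (π : Permutation′ (3 ℕ.+ m)) →
                   count (fixedᵇ (π ⟨$⟩ʳ_)) ≡ m → inversionParity (π ⟨$⟩ʳ_) ≡ false
three-moved-even zero π no-fixed-points =
  trans (inversionParity-cong (as-table (π ⟨$⟩ʳ_)))
        (fixed-point-free-Fin3-even _ _ _
          ((λ ()) ∘ permutation-injective π) ((λ ()) ∘ permutation-injective π) ((λ ()) ∘ permutation-injective π)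
          (trans (sym (fixedPoints-cong (as-table (π ⟨$⟩ʳ_)))) no-fixed-points))
three-moved-even (suc m) π fixed-count with count-witness (fixedᵇ (π ⟨$⟩ʳ_)) fixed-count
... | l , l-fixed = trans Smaller.inversions
  (three-moved-even m Smaller.π′ (ℕP.suc-injective (trans (sym Smaller.fixed-count) fixed-count)))
  where module Smaller = RemoveFixedPoint π l (fixedᵇ-true (π ⟨$⟩ʳ_) l l-fixed)

codeParity-three-moved : ∀ m (c : Code (3 ℕ.+ m)) → fixedPoints c ≡ m → codeParity c ≡ false
codeParity-three-moved m c fixed = trans (codeParity≡inversionParity c) (three-moved-even m (perm c) fixed)

-- Sums of integers are rigid under pointwise inequalities.

+-rigid : ∀ {a b c d : ℤ} → c ≤ a → d ≤ b → a + b ≡ c + d → a ≡ c × b ≡ d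
+-rigid {a} {b} {c} {d} c≤a d≤b a+b≡c+d = first , second
  where
  first : a ≡ c
  first with a ℤ.≟ c
  ... | yes a≡c = a≡c
  ... | no  a≢c =
    ⊥-elim (ℤP.<-irrefl (sym a+b≡c+d) (ℤP.+-mono-<-≤ (ℤP.≤∧≢⇒< c≤a (a≢c ∘ sym)) d≤b))
  second : b ≡ d
  second with b ℤ.≟ d
  ... | yes b≡d = b≡d
  ... | no  b≢d =
    ⊥-elim (ℤP.<-irrefl (sym a+b≡c+d) (ℤP.+-mono-≤-< c≤a (ℤP.≤∧≢⇒< d≤b (b≢d ∘ sym))))

sum-mono : ∀ {n} {f g : Fin n → ℤ} → (∀ i → g i ≤ f i) → ℤSum.sum g ≤ ℤSum.sum f
sum-mono {zero}  g≤f = ℤP.≤-refl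
sum-mono {suc n} g≤f = ℤP.+-mono-≤ (g≤f zero) (sum-mono (g≤f ∘ suc))

sum-rigid : ∀ {n} {f g : Fin n → ℤ} → (∀ i → g i ≤ f i) →
            ℤSum.sum f ≡ ℤSum.sum g → ∀ i → f i ≡ g i
sum-rigid {suc n} g≤f same-sum zero    = proj₁ (+-rigid (g≤f zero) (sum-mono (g≤f ∘ suc)) same-sum)
sum-rigid {suc n} g≤f same-sum (suc i) =
  sum-rigid (g≤f ∘ suc) (proj₂ (+-rigid (g≤f zero) (sum-mono (g≤f ∘ suc)) same-sum)) i

sumCodes-mono : ∀ {n} {f g : Code n → ℤ} → (∀ c → g c ≤ f c) → sumCodes g ≤ sumCodes f
sumCodes-mono {zero}  g≤f = g≤f tt
sumCodes-mono {suc n} g≤f = sum-mono (λ j → sumCodes-mono (λ c → g≤f (j , c)))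

sumCodes-rigid : ∀ {n} {f g : Code n → ℤ} → (∀ c → g c ≤ f c) →
                 sumCodes f ≡ sumCodes g → ∀ c → f c ≡ g c
sumCodes-rigid {zero}  g≤f same-sum tt      = same-sum
sumCodes-rigid {suc n} g≤f same-sum (j , c) =
  sumCodes-rigid (λ c → g≤f (j , c))
    (sum-rigid (λ j → sumCodes-mono (λ c → g≤f (j , c))) same-sum j) c

-- Three-cycles, their moved points and their weights.

encode : ∀ {n} → Permutation′ n → Code n
encode {zero}  π = tt
encode {suc n} π = π ⟨$⟩ʳ zero , encode (remove zero π)

perm-encode : ∀ {n} (π : Permutation′ n) i → perm (encode π) ⟨$⟩ʳ i ≡ π ⟨$⟩ʳ i
perm-encode {suc n} π zero    = refl
perm-encode {suc n} π (suc i) =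
  trans (cong (punchIn (π ⟨$⟩ʳ zero)) (perm-encode (remove zero π) i)) (sym (punchIn-permute π zero i))

rotate : ∀ {n} → Fin n → Fin n → Fin n → Fin n → Fin n
rotate x y z i with i ≟ x
... | yes _ = y
... | no  _ with i ≟ y
...   | yes _ = z
...   | no  _ with i ≟ z
...     | yes _ = x
...     | no  _ = i

rotate-first : ∀ {n} (x y z : Fin n) → rotate x y z x ≡ y
rotate-first x y z with x ≟ x
... | yes _   = refl
... | no  x≢x = ⊥-elim (x≢x refl)

rotate-second : ∀ {n} {x y : Fin n} z → x ≢ y → rotate x y z y ≡ z
rotate-second {x = x} {y} z x≢y with y ≟ x
... | yes y≡x = ⊥-elim (x≢y (sym y≡x))
... | no  _ with y ≟ y
...   | yes _   = refl
...   | no  y≢y = ⊥-elim (y≢y refl)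

rotate-third : ∀ {n} {x y z : Fin n} → x ≢ z → y ≢ z → rotate x y z z ≡ x
rotate-third {x = x} {y} {z} x≢z y≢z with z ≟ x
... | yes z≡x = ⊥-elim (x≢z (sym z≡x))
... | no  _ with z ≟ y
...   | yes z≡y = ⊥-elim (y≢z (sym z≡y))
...   | no  _ with z ≟ z
...     | yes _   = refl
...     | no  z≢z = ⊥-elim (z≢z refl)

rotate-others : ∀ {n} {x y z i : Fin n} → i ≢ x → i ≢ y → i ≢ z → rotate x y z i ≡ i
rotate-others {x = x} {y} {z} {i} i≢x i≢y i≢z with i ≟ x
... | yes i≡x = ⊥-elim (i≢x i≡x)
... | no  _ with i ≟ y
...   | yes i≡y = ⊥-elim (i≢y i≡y)
...   | no  _ with i ≟ z
...     | yes i≡z = ⊥-elim (i≢z i≡z)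
...     | no  _   = refl

rotate-inverse : ∀ {n} {x y z : Fin n} → x ≢ y → x ≢ z → y ≢ z → ∀ i → rotate z y x (rotate x y z i) ≡ i
rotate-inverse {x = x} {y} {z} x≢y x≢z y≢z i = by-cases (i ≟ x) (i ≟ y) (i ≟ z)
  where
  by-cases : Dec (i ≡ x) → Dec (i ≡ y) → Dec (i ≡ z) → rotate z y x (rotate x y z i) ≡ i
  by-cases (yes refl) _          _          =
    trans (cong (rotate z y x) (rotate-first x y z)) (rotate-second x (y≢z ∘ sym))
  by-cases (no  _)    (yes refl) _          =
    trans (cong (rotate z y x) (rotate-second z x≢y)) (rotate-first z y x)
  by-cases (no  _)    (no  _)    (yes refl) =
    trans (cong (rotate z y x) (rotate-third x≢z y≢z)) (rotate-third (x≢z ∘ sym) (x≢y ∘ sym))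
  by-cases (no  i≢x)  (no  i≢y)  (no  i≢z)  =
    trans (cong (rotate z y x) (rotate-others i≢x i≢y i≢z)) (rotate-others i≢z i≢y i≢x)

threeCycle : ∀ {n} {x y z : Fin n} → x ≢ y → x ≢ z → y ≢ z → Permutation′ n
threeCycle {x = x} {y} {z} x≢y x≢z y≢z = Perm.permutation (rotate x y z) (rotate z y x)
  (rotate-inverse (y≢z ∘ sym) (x≢z ∘ sym) (x≢y ∘ sym)) (rotate-inverse x≢y x≢z y≢z)

movedᵇ-true : ∀ {n} (f : Fin n → Fin n) {i} → f i ≢ i → movedᵇ f i ≡ true
movedᵇ-true f {i} fi≢i = cong not (dec-false (i ≟ f i) (fi≢i ∘ sym))

movedᵇ-false : ∀ {n} (f : Fin n → Fin n) {i} → f i ≡ i → movedᵇ f i ≡ false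
movedᵇ-false f {i} fi≡i = cong not (dec-true (i ≟ f i) (sym fi≡i))

module ℕSupport = SumSupport ℕP.+-0-commutativeMonoid

rotate-moves-three : ∀ {n} {x y z : Fin (suc n)} → x ≢ y → x ≢ z → y ≢ z →
                     count (movedᵇ (rotate x y z)) ≡ 3
rotate-moves-three {n} {x} {y} {z} x≢y x≢z y≢z =
  trans (ℕSupport.sum-support₃ (indicator moved) x y z x≢y x≢z y≢z vanish)
        (cong₂ ℕ._+_ (one (rotate-first x y z) x≢y)
                     (cong₂ ℕ._+_ (one (rotate-second z x≢y) y≢z) (one (rotate-third x≢z y≢z) (x≢z ∘ sym))))
  where
  moved : Fin (suc n) → Bool
  moved = movedᵇ (rotate x y z)
  one : ∀ {i j} → rotate x y z i ≡ j → i ≢ j → indicator moved i ≡ 1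
  one ri≡j i≢j = cong (λ b → if b then 1 else 0) (movedᵇ-true (rotate x y z) (i≢j ∘ sym ∘ trans (sym ri≡j)))
  vanish : ∀ i → i ≢ x → i ≢ y → i ≢ z → indicator moved i ≡ 0
  vanish i i≢x i≢y i≢z =
    cong (λ b → if b then 1 else 0) (movedᵇ-false (rotate x y z) (rotate-others i≢x i≢y i≢z))

rotate-weight : ∀ {n} (A : Fin (suc n) → Fin (suc n) → Bool) {x y z : Fin (suc n)} →
                x ≢ y → x ≢ z → y ≢ z →
                weight A (rotate x y z) ≡ not (A x y) xor (not (A y z) xor not (A z x))
rotate-weight A {x} {y} {z} x≢y x≢z y≢z =
  trans (XorSupport.sum-support₃ summand x y z x≢y x≢z y≢z vanish)
        (cong₂ _xor_ (edge (rotate-first x y z) x≢y)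
                     (cong₂ _xor_ (edge (rotate-second z x≢y) y≢z) (edge (rotate-third x≢z y≢z) (x≢z ∘ sym))))
  where
  summand : Fin (suc _) → Bool
  summand i = movedᵇ (rotate x y z) i ∧ not (A i (rotate x y z i))
  edge : ∀ {i j} → rotate x y z i ≡ j → i ≢ j → summand i ≡ not (A i j)
  edge ri≡j i≢j = cong₂ (λ b k → b ∧ not (A _ k))
                        (movedᵇ-true (rotate x y z) (i≢j ∘ sym ∘ trans (sym ri≡j))) ri≡j
  vanish : ∀ i → i ≢ x → i ≢ y → i ≢ z → summand i ≡ false
  vanish i i≢x i≢y i≢z =
    cong (λ b → b ∧ not (A i (rotate x y z i))) (movedᵇ-false (rotate x y z) (rotate-others i≢x i≢y i≢z))

-- Graphs cospectral with a complete bipartite graph.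

bipartite : ∀ {n} → (Fin n → Bool) → Fin n → Fin n → Bool
bipartite L i j = L i xor L j

-- Switching invariance: in a complete bipartite graph the weight of a
-- permutation only counts its moved points.
weight-bipartite : ∀ {n} (L : Fin n → Bool) (π : Permutation′ n) →
                   weight (bipartite L) (π ⟨$⟩ʳ_) ≡ parity (movedᵇ (π ⟨$⟩ʳ_))
weight-bipartite L π = begin
  parity (λ i → movedᵇ f i ∧ not (L i xor L (f i)))
    ≡⟨ XorSum.sum-cong-≗ summand ⟩
  parity (λ i → movedᵇ f i xor (L i xor L (f i)))
    ≡⟨ XorSum.∑-distrib-+ (movedᵇ f) (λ i → L i xor L (f i)) ⟩
  parity (movedᵇ f) xor parity (λ i → L i xor L (f i))
    ≡⟨ cong (parity (movedᵇ f) xor_) (XorSum.∑-distrib-+ L (L ∘ f)) ⟩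
  parity (movedᵇ f) xor (parity L xor parity (L ∘ f))
    ≡⟨ cong (λ p → parity (movedᵇ f) xor (parity L xor p)) (parity-permute L π) ⟩
  parity (movedᵇ f) xor (parity L xor parity L)
    ≡⟨ cong (parity (movedᵇ f) xor_) (xor-same (parity L)) ⟩
  parity (movedᵇ f) xor false
    ≡⟨ xor-identityʳ _ ⟩
  parity (movedᵇ f)
    ∎
  where
  open ≡-Reasoning
  f : Fin _ → Fin _
  f = π ⟨$⟩ʳ_
  summand : ∀ i → movedᵇ f i ∧ not (L i xor L (f i)) ≡ movedᵇ f i xor (L i xor L (f i))
  summand i with i ≟ f i
  ... | yes i≡fi = sym (trans (cong (λ j → L i xor L j) (sym i≡fi)) (xor-same (L i)))
  ... | no  _    = refl

moved-three : ∀ {m} (b : Fin (3 ℕ.+ m) → Bool) → count b ≡ m → count (not ∘ b) ≡ 3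
moved-three {m} b fixed = ℕP.+-cancelˡ-≡ m (count (not ∘ b)) 3
  (trans (trans (cong (ℕ._+ count (not ∘ b)) (sym fixed)) (count-complement b)) (ℕP.+-comm 3 m))

fixed-all-but-three : ∀ {m} (b : Fin (3 ℕ.+ m) → Bool) → count (not ∘ b) ≡ 3 → count b ≡ m
fixed-all-but-three {m} b moved = ℕP.+-cancelʳ-≡ 3 (count b) m
  (trans (trans (cong (count b ℕ.+_) (sym moved)) (count-complement b)) (ℕP.+-comm 3 m))

term-at-fixedPoints : ∀ {n} A k (c : Code n) → fixedPoints c ≡ k →
                      term A k c ≡ signed (codeParity c xor weight A (perm c ⟨$⟩ʳ_)) 1ℤ
term-at-fixedPoints A k c fixed with k ℕ.≡ᵇ fixedPoints c in k≡ᵇd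
... | true  = refl
... | false = ⊥-elim (subst T k≡ᵇd (ℕP.≡⇒≡ᵇ k (fixedPoints c) (sym fixed)))

-1≤signed : ∀ b → -1ℤ ≤ signed b 1ℤ
-1≤signed true  = ℤP.≤-refl
-1≤signed false = ℤ.-≤+

signed-one-injective : ∀ a b → signed a 1ℤ ≡ signed b 1ℤ → a ≡ b
signed-one-injective true  true  _  = refl
signed-one-injective true  false ()
signed-one-injective false true  ()
signed-one-injective false false _  = refl

-- In a graph with the Seidel coefficients of the complete bipartite graph
-- on 3 + m vertices, every permutation moving three points has weight
-- true: in the bipartite graph each such permutation contributes the
-- least possible value −1 to the coefficient of x^m.
module CospectralWithBipartite {m} (A : Fin (3 ℕ.+ m) → Fin (3 ℕ.+ m) → Bool) (L : Fin (3 ℕ.+ m) → Bool)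
  (same-coeff : ∀ k → sumCodes (term A k) ≡ sumCodes (term (bipartite L) k)) where

  bipartite-term : ∀ c → fixedPoints c ≡ m → term (bipartite L) m c ≡ -1ℤ
  bipartite-term c fixed = trans (term-at-fixedPoints (bipartite L) m c fixed)
    (cong (λ s → signed s 1ℤ) (cong₂ _xor_ (codeParity-three-moved m c fixed) moved-parity))
    where
    π : Fin (3 ℕ.+ m) → Fin (3 ℕ.+ m)
    π = perm c ⟨$⟩ʳ_
    moved-parity : weight (bipartite L) π ≡ true
    moved-parity = trans (weight-bipartite L (perm c))
      (trans (parity≡odd-count (movedᵇ π)) (cong odd (moved-three (fixedᵇ π) fixed)))

  bipartite-below : ∀ c → term (bipartite L) m c ≤ term A m c
  bipartite-below c with fixedPoints c ℕ.≟ m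
  ... | yes fixed = subst₂ _≤_ (sym (bipartite-term c fixed)) (sym (term-at-fixedPoints A m c fixed))
                           (-1≤signed (codeParity c xor weight A (perm c ⟨$⟩ʳ_)))
  ... | no  ¬fixed = ℤP.≤-reflexive (trans (term-off (bipartite L) m c (¬fixed ∘ sym))
                                           (sym (term-off A m c (¬fixed ∘ sym))))

  three-moved-weight : ∀ c → fixedPoints c ≡ m → weight A (perm c ⟨$⟩ʳ_) ≡ true
  three-moved-weight c fixed = signed-one-injective _ true (begin
    signed (weight A (perm c ⟨$⟩ʳ_)) 1ℤ
      ≡⟨ cong (λ p → signed (p xor weight A (perm c ⟨$⟩ʳ_)) 1ℤ) (sym (codeParity-three-moved m c fixed)) ⟩
    signed (codeParity c xor weight A (perm c ⟨$⟩ʳ_)) 1ℤ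
      ≡⟨ sym (term-at-fixedPoints A m c fixed) ⟩
    term A m c
      ≡⟨ sumCodes-rigid bipartite-below (same-coeff m) c ⟩
    term (bipartite L) m c
      ≡⟨ bipartite-term c fixed ⟩
    -1ℤ
      ∎)
    where open ≡-Reasoning

  -- Applied to the three-cycle 0 ↦ a ↦ b ↦ 0: every triangle through the
  -- vertex 0 has an even number of non-edges.
  triangle : ∀ {a b} → zero ≢ a → zero ≢ b → a ≢ b → A a b ≡ A zero a xor A b zero
  triangle {a} {b} 0≢a 0≢b a≢b = odd-triangle (A zero a) (A a b) (A b zero) (begin
    not (A zero a) xor (not (A a b) xor not (A b zero))
      ≡⟨ sym (rotate-weight A 0≢a 0≢b a≢b) ⟩
    weight A (rotate zero a b)
      ≡⟨ sym (weight-cong A (perm-encode cycle)) ⟩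
    weight A (perm (encode cycle) ⟨$⟩ʳ_)
      ≡⟨ three-moved-weight (encode cycle) cycle-fixes-m ⟩
    true
      ∎)
    where
    open ≡-Reasoning
    cycle : Permutation′ (3 ℕ.+ m)
    cycle = threeCycle 0≢a 0≢b a≢b
    cycle-fixes-m : fixedPoints (encode cycle) ≡ m
    cycle-fixes-m = trans (fixedPoints-cong (perm-encode cycle))
                          (fixed-all-but-three (fixedᵇ (rotate zero a b)) (rotate-moves-three 0≢a 0≢b a≢b))
    odd-triangle : ∀ x y z → not x xor (not y xor not z) ≡ true → y ≡ x xor z
    odd-triangle true  true  true  ()
    odd-triangle true  true  false _  = refl
    odd-triangle true  false true  _  = refl
    odd-triangle true  false false ()
    odd-triangle false true  true  _  = refl
    odd-triangle false true  false ()
    odd-triangle false false true  ()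
    odd-triangle false false false _  = refl

triangle-condition : ∀ {n} (H : Graph (suc n)) (L : Fin (suc n) → Bool) →
                     (∀ k → sumCodes (term (adj H) k) ≡ sumCodes (term (bipartite L) k)) →
                     ∀ a b → a ≢ b → adj H (suc a) (suc b) ≡ adj H zero (suc a) xor adj H zero (suc b)
triangle-condition {suc zero}    H L same-coeff zero zero a≢b = ⊥-elim (a≢b refl)
triangle-condition {suc (suc m)} H L same-coeff a    b    a≢b =
  trans (CospectralWithBipartite.triangle (adj H) L same-coeff (λ ()) (λ ()) (a≢b ∘ suc-injective))
        (cong (adj H zero (suc a) xor_) (Graph.sym H (suc b) zero))

-- Switching to the complete bipartite graph.

adjacency-through-zero : ∀ {n} (H : Graph (suc n)) →
  (∀ a b → a ≢ b → adj H (suc a) (suc b) ≡ adj H zero (suc a) xor adj H zero (suc b)) →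
  ∀ i j → adj H i j ≡ adj H zero i xor adj H zero j
adjacency-through-zero H triangles zero    zero    = trans (irrefl H zero) (sym (xor-same (adj H zero zero)))
adjacency-through-zero H triangles zero    (suc j) = cong (_xor adj H zero (suc j)) (sym (irrefl H zero))
adjacency-through-zero H triangles (suc i) zero    =
  trans (Graph.sym H (suc i) zero)
        (sym (trans (cong (adj H zero (suc i) xor_) (irrefl H zero)) (xor-identityʳ _)))
adjacency-through-zero H triangles (suc i) (suc j) with i ≟ j
... | yes refl = trans (irrefl H (suc i)) (sym (xor-same (adj H zero (suc i))))
... | no  i≢j  = triangles i j i≢j

switchAdj-xor : ∀ {n} (H : Graph n) U i j → switchAdj H U i j ≡ (U i xor U j) xor adj H i j
switchAdj-xor H U i j with U i xor U j
... | true  = refl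
... | false = refl

switch-to-bipartite : ∀ {n} (H : Graph (suc n)) (L : Fin (suc n) → Bool) →
                      (∀ i j → adj H i j ≡ adj H zero i xor adj H zero j) →
                      ∀ i j → switchAdj H (λ v → adj H zero v xor L v) i j ≡ bipartite L i j
switch-to-bipartite {n} H L through-zero i j = begin
  switchAdj H (λ v → x v xor L v) i j
    ≡⟨ switchAdj-xor H (λ v → x v xor L v) i j ⟩
  ((x i xor L i) xor (x j xor L j)) xor adj H i j
    ≡⟨ cong (((x i xor L i) xor (x j xor L j)) xor_) (through-zero i j) ⟩
  ((x i xor L i) xor (x j xor L j)) xor (x i xor x j)
    ≡⟨ cong (_xor (x i xor x j)) (xor-interchange (x i) (L i) (x j) (L j)) ⟩
  ((x i xor x j) xor (L i xor L j)) xor (x i xor x j)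
    ≡⟨ cong (_xor (x i xor x j)) (xor-comm (x i xor x j) (L i xor L j)) ⟩
  ((L i xor L j) xor (x i xor x j)) xor (x i xor x j)
    ≡⟨ xor-assoc (L i xor L j) (x i xor x j) (x i xor x j) ⟩
  (L i xor L j) xor ((x i xor x j) xor (x i xor x j))
    ≡⟨ cong ((L i xor L j) xor_) (xor-same (x i xor x j)) ⟩
  (L i xor L j) xor false
    ≡⟨ xor-identityʳ (L i xor L j) ⟩
  L i xor L j
    ∎
  where
  open ≡-Reasoning
  x : Fin (suc n) → Bool
  x = adj H zero

term-adj-cong : ∀ {n} {A B : Fin n → Fin n → Bool} → (∀ i j → A i j ≡ B i j) →
                ∀ k c → term A k c ≡ term B k c
term-adj-cong A≡B k c = cong (λ w → signedMonomial (fixedPoints c) (codeParity c xor w) k)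
  (XorSum.sum-cong-≗ (λ i → cong (λ e → movedᵇ (perm c ⟨$⟩ʳ_) i ∧ not e) (A≡B i (perm c ⟨$⟩ʳ i))))

cospectral-terms : ∀ {m n} (H : Graph m) (G : Graph n) → SeidelCospectral H G →
                   ∀ k → sumCodes (term (adj H) k) ≡ sumCodes (term (adj G) k)
cospectral-terms H G cospectral k = trans (sym (seidel-coeff H k)) (trans (cospectral k) (seidel-coeff G k))

complete-bipartite-S-determined : ∀ {n} (G : Graph (suc n)) (L : Fin (suc n) → Bool) →
                                  (∀ i j → adj G i j ≡ L i xor L j) → SDetermined G
complete-bipartite-S-determined G L G-bipartite H cospectral
  with same-order (adj H) (adj G) (cospectral-terms H G cospectral)
... | refl = (λ v → adj H zero v xor L v) , id , id , (λ _ → refl) , (λ _ → refl) , switched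
  where
  same-as-bipartite : ∀ k → sumCodes (term (adj H) k) ≡ sumCodes (term (bipartite L) k)
  same-as-bipartite k =
    trans (cospectral-terms H G cospectral k) (sumCodes-cong (term-adj-cong G-bipartite k))
  switched : ∀ i j → adj G i j ≡ switchAdj H (λ v → adj H zero v xor L v) i j
  switched i j = trans (G-bipartite i j) (sym (switch-to-bipartite H L
    (adjacency-through-zero H (triangle-condition H L same-as-bipartite)) i j))

-- K p q is the complete bipartite graph of inLeft p; p ≥ 1 provides the
-- vertex 0 used for switching.
theorem3p6 : ∀ (p q : ℕ) → p ≥ 1 → q ≥ 1 → SDetermined (K p q)
theorem3p6 (suc p) q (ℕ.s≤s ℕ.z≤n) _ =
  complete-bipartite-S-determined (K (suc p) q) (inLeft (suc p)) (λ _ _ → refl)
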